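{- Let $Q$ be a $k\times n$ partial Latin array with $|Q|=o(k\sqrt n)$. Let $\mathbf A(Q)$ be the random $k\times n$ array obtained from $Q$ by independently putting a uniformly random symbol from $\{1,\dots,n\}$ in each empty cell. Then \[\mathbb E[N(\mathbf A(Q))]\le\frac{k^2}{4}+N(Q)+o(k^2).\]
   Context: A $k\times n$ partial Latin array is a $k\times n$ array with some cells filled with symbols from $\{1,\dots,n\}$, no symbol appearing more than once in any row or column; $|Q|$ is its number of nonempty cells. For an array $A$ (not necessarily Latin), $N(A)$ denotes the number of intercalates: pairs of rows $i<j$ and columns $x<y$ such that all four cells are filled and $A_{i,x}=A_{j,y}$, $A_{i,y}=A_{j,x}$ (in particular a $2\times 2$ subarray with all four entries equal counts). Asymptotics are as $n\to\infty$. -}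

module Defs where

open import Data.Nat using (ℕ; zero; suc; _+_; _*_; _<ᵇ_)
open import Data.Bool using (Bool; true; false; _∧_; if_then_else_)
open import Data.Fin using (Fin; toℕ; _≟_)
open import Data.Maybe using (Maybe; just; nothing)
open import Data.List using (List; []; _∷_; map; concatMap; allFin)
open import Data.Nat.ListAction using (sum)
open import Data.Product using (_×_)
open import Relation.Nullary using (¬_)
open import Relation.Nullary.Decidable using (⌊_⌋)
open import Relation.Binary.PropositionalEquality using (_≡_; _≢_)

PArray : ℕ → ℕ → Set
PArray k n = Fin k → Fin n → Maybe (Fin n)

TArray : ℕ → ℕ → Set
TArray k n = Fin k → Fin n → Fin n

IsPartialLatin : ∀ {k n} → PArray k n → Set
IsPartialLatin {k} {n} Q =
  (∀ (i : Fin k) (x y : Fin n) (s : Fin n) → x ≢ y → Q i x ≡ just s → ¬ (Q i y ≡ just s)) ×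
  (∀ (i j : Fin k) (x : Fin n) (s : Fin n) → i ≢ j → Q i x ≡ just s → ¬ (Q j x ≡ just s))

ΣF : (m : ℕ) → (Fin m → ℕ) → ℕ
ΣF m f = sum (map f (allFin m))

isJust? : ∀ {A : Set} → Maybe A → ℕ
isJust? (just _) = 1
isJust? nothing  = 0

size : ∀ {k n} → PArray k n → ℕ
size {k} {n} Q = ΣF k λ i → ΣF n λ x → isJust? (Q i x)

eqM : ∀ {n} → Maybe (Fin n) → Maybe (Fin n) → Bool
eqM (just a) (just b) = ⌊ a ≟ b ⌋
eqM _ _ = false

interc : ∀ {k n} → PArray k n → Fin k → Fin k → Fin n → Fin n → ℕ
interc A i j x y =
  if (toℕ i <ᵇ toℕ j) ∧ (toℕ x <ᵇ toℕ y) ∧ eqM (A i x) (A j y) ∧ eqM (A i y) (A j x)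
  then 1 else 0

N : ∀ {k n} → PArray k n → ℕ
N {k} {n} A = ΣF k λ i → ΣF k λ j → ΣF n λ x → ΣF n λ y → interc A i j x y

full : ∀ {k n} → TArray k n → PArray k n
full B i x = just (B i x)

allFunsOf : ∀ {A : Set} (m : ℕ) → List A → List (Fin m → A)
allFunsOf zero    xs = (λ ()) ∷ []
allFunsOf (suc m) xs =
  concatMap (λ a → map (λ f → λ { Fin.zero → a ; (Fin.suc i) → f i }) (allFunsOf m xs)) xs
  where import Data.Fin as Fin

allArrays : (k n : ℕ) → List (TArray k n)
allArrays k n = allFunsOf k (allFunsOf n (allFin n))

agrees : ∀ {k n} → PArray k n → TArray k n → Bool
agrees {k} {n} Q B = allB k λ i → allB n λ x → cell (Q i x) (B i x)
  where
  allB : (m : ℕ) → (Fin m → Bool) → Bool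
  allB m f = Data.List.foldr _∧_ true (map f (allFin m))
    where import Data.List
  cell : Maybe (Fin n) → Fin n → Bool
  cell nothing  _ = true
  cell (just s) b = ⌊ s ≟ b ⌋

-- The random array A(Q) (independent uniform symbol in each empty cell) is the uniform
-- distribution on completions of Q. Hence
--   E[N(A(Q))] = completionSum Q / completionCount Q.
completionSum : ∀ {k n} → PArray k n → ℕ
completionSum {k} {n} Q = sum (map (λ B → if agrees Q B then N (full B) else 0) (allArrays k n))

completionCount : ∀ {k n} → PArray k n → ℕ
completionCount {k} {n} Q = sum (map (λ B → if agrees Q B then 1 else 0) (allArrays k n))

-- Write N as a sum over quadruples (i < j, x < y) of rows and columns. In a random completion
-- B of Q, resampling an empty cell uniformly shows that two distinct cells agree with
-- probability at most 1/n, unless both are filled in Q, in which case the event is decided by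
-- Q. Applying this first to the diagonal pair (i,x),(j,y) and then to the antidiagonal pair
-- (i,y),(j,x) bounds the probability of an intercalate at the quadruple by (1/n + D₁)(1/n + D₂),
-- where D₁, D₂ indicate equal filled symbols of Q on the diagonal and antidiagonal. Summing:
-- the 1/n² term gives at most (k²/2)(n²/2)/n² = k²/4, the products D₁D₂ give N(Q), and the
-- cross terms give at most 2k|Q|/n, because a symbol occurs at most once in each row of Q.
-- Taking d = 2e, the sparsity hypothesis gives 2e|Q| ≤ kn, so 2k|Q|/n ≤ k²/e.

module Submission where

open import Defs
open import Data.Nat.Properties hiding (suc-injective) renaming (_≟_ to _≟ℕ_)
open import Algebra.Properties.CommutativeSemigroup +-commutativeSemigroup using (interchange)
open import Algebra.Properties.CommutativeSemigroup *-commutativeSemigroup using (x∙yz≈y∙xz)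
open import Algebra.Properties.CommutativeSemiring.Exp +-*-commutativeSemiring using (^-distrib-*)
open import Data.Bool using (Bool; true; false; T; _∧_; if_then_else_)
open import Data.Bool.Properties using (T?)
open import Data.Empty using (⊥-elim)
open import Data.Fin using (Fin; zero; suc; toℕ; _≟_)
open import Data.Fin.Properties using (¬∀⟶∃¬; suc-injective)
open import Data.List using (List; []; _∷_; _++_; length; map; concatMap; allFin; cartesianProduct)
open import Data.List.Properties using (map-++; map-cong; map-∘; map-tabulate; length-tabulate)
open import Data.List.Relation.Unary.All.Properties using (all⁺; all⁻; tabulate⁺; tabulate⁻)
open import Data.Maybe using (Maybe; just; nothing)
open import Data.Nat using (ℕ; zero; suc; _+_; _*_; _^_; _≤_; _<ᵇ_; z≤n; NonZero)
open import Data.Nat.ListAction using (sum)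
open import Data.Nat.ListAction.Properties using (sum-++)
open import Data.Nat.Tactic.RingSolver using (solve-∀)
open import Data.Product using (Σ; _×_; _,_; proj₁; proj₂)
open import Data.Vec.Functional using (Vector; updateAt) renaming (_∷_ to _◂_)
open import Data.Vec.Functional.Properties using (updateAt-updates; updateAt-minimal)
open import Data.Vec.Functional.Relation.Binary.Pointwise using (Pointwise)
open import Function using (_∘_; _$_; const)
open import Relation.Binary.Core using (_Preserves_⟶_)
open import Relation.Binary.Definitions using (Reflexive)
open import Relation.Binary.PropositionalEquality
open import Relation.Nullary using (¬_; yes; no; contradiction)
open import Relation.Nullary.Decidable using (⌊_⌋; ⌊⌋-map′; toWitness; fromWitness)

private
  variable
    A B : Set

ΣL : (A → ℕ) → List A → ℕ
ΣL f xs = sum (map f xs)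

ΣL-cong : {f g : A → ℕ} → (∀ a → f a ≡ g a) → ∀ xs → ΣL f xs ≡ ΣL g xs
ΣL-cong f≗g xs = cong sum (map-cong f≗g xs)

ΣL-mono : {f g : A → ℕ} → (∀ a → f a ≤ g a) → ∀ xs → ΣL f xs ≤ ΣL g xs
ΣL-mono f≤g []       = z≤n
ΣL-mono f≤g (a ∷ xs) = +-mono-≤ (f≤g a) (ΣL-mono f≤g xs)

ΣL-zero : {f : A → ℕ} → (∀ a → f a ≡ 0) → ∀ xs → ΣL f xs ≡ 0
ΣL-zero f≗0 []       = refl
ΣL-zero f≗0 (a ∷ xs) = cong₂ _+_ (f≗0 a) (ΣL-zero f≗0 xs)

*-ΣL-zero : ∀ c {f : A → ℕ} → (∀ a → f a ≡ 0) → ∀ xs → c * ΣL f xs ≡ 0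
*-ΣL-zero c f≗0 xs = trans (cong (c *_) (ΣL-zero f≗0 xs)) (*-zeroʳ c)

ΣL-+ : (f g : A → ℕ) → ∀ xs → ΣL (λ a → f a + g a) xs ≡ ΣL f xs + ΣL g xs
ΣL-+ f g []       = refl
ΣL-+ f g (a ∷ xs) =
  trans (cong (f a + g a +_) (ΣL-+ f g xs)) (interchange (f a) (g a) (ΣL f xs) (ΣL g xs))

ΣL-*ˡ : ∀ c (f : A → ℕ) xs → ΣL (λ a → c * f a) xs ≡ c * ΣL f xs
ΣL-*ˡ c f []       = sym (*-zeroʳ c)
ΣL-*ˡ c f (a ∷ xs) = trans (cong (c * f a +_) (ΣL-*ˡ c f xs)) (sym (*-distribˡ-+ c (f a) _))

ΣL-*ʳ : ∀ c (f : A → ℕ) xs → ΣL (λ a → f a * c) xs ≡ ΣL f xs * c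
ΣL-*ʳ c f xs =
  trans (ΣL-cong (λ a → *-comm (f a) c) xs) (trans (ΣL-*ˡ c f xs) (*-comm c (ΣL f xs)))

ΣL-++ : (f : A → ℕ) → ∀ xs ys → ΣL f (xs ++ ys) ≡ ΣL f xs + ΣL f ys
ΣL-++ f xs ys = trans (cong sum (map-++ f xs ys)) (sum-++ (map f xs) (map f ys))

ΣL-map : (f : B → ℕ) (g : A → B) → ∀ xs → ΣL f (map g xs) ≡ ΣL (f ∘ g) xs
ΣL-map f g xs = cong sum (sym (map-∘ xs))

ΣL-concatMap : (f : B → ℕ) (g : A → List B) → ∀ xs →
  ΣL f (concatMap g xs) ≡ ΣL (λ a → ΣL f (g a)) xs
ΣL-concatMap f g []       = refl
ΣL-concatMap f g (a ∷ xs) =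
  trans (ΣL-++ f (g a) (concatMap g xs)) (cong (ΣL f (g a) +_) (ΣL-concatMap f g xs))

ΣL-swap : (h : A → B → ℕ) → ∀ xs ys →
  ΣL (λ a → ΣL (h a) ys) xs ≡ ΣL (λ b → ΣL (λ a → h a b) xs) ys
ΣL-swap h []       ys = sym (ΣL-zero (λ _ → refl) ys)
ΣL-swap h (a ∷ xs) ys =
  trans (cong (ΣL (h a) ys +_) (ΣL-swap h xs ys)) (sym (ΣL-+ (h a) _ ys))

ΣL-const : ∀ c xs → ΣL (λ (_ : A) → c) xs ≡ length xs * c
ΣL-const c []       = refl
ΣL-const c (_ ∷ xs) = cong (c +_) (ΣL-const c xs)

ΣL-cartesianProduct : (f : A × B → ℕ) → ∀ xs ys →
  ΣL f (cartesianProduct xs ys) ≡ ΣL (λ a → ΣL (λ b → f (a , b)) ys) xs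
ΣL-cartesianProduct f []       ys = refl
ΣL-cartesianProduct f (a ∷ xs) ys = begin
  ΣL f (map (a ,_) ys ++ cartesianProduct xs ys)
    ≡⟨ ΣL-++ f (map (a ,_) ys) _ ⟩
  ΣL f (map (a ,_) ys) + ΣL f (cartesianProduct xs ys)
    ≡⟨ cong₂ _+_ (ΣL-map f (a ,_) ys) (ΣL-cartesianProduct f xs ys) ⟩
  ΣL (λ b → f (a , b)) ys + ΣL (λ a → ΣL (λ b → f (a , b)) ys) xs ∎
  where open ≡-Reasoning

ΣL-allFin-const : ∀ m c → ΣL (λ (_ : Fin m) → c) (allFin m) ≡ m * c
ΣL-allFin-const m c = trans (ΣL-const c (allFin m)) (cong (_* c) (length-tabulate {n = m} (λ i → i)))

ΣL-allFin-suc : ∀ {m} (f : Fin (suc m) → ℕ) →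
  ΣL f (allFin (suc m)) ≡ f zero + ΣL (f ∘ suc) (allFin m)
ΣL-allFin-suc {m} f =
  cong (λ xs → f zero + sum xs) (trans (map-tabulate suc f) (sym (map-tabulate (λ i → i) (f ∘ suc))))

-- Resampling one coordinate

-- The multiset {u v a | v ∈ vs, a ∈ xs} is c copies of xs, as seen by ≈-invariant weights.
record Resamples {V : Set} (_≈_ : A → A → Set) (xs : List A) (vs : List V) (c : ℕ)
                 (u : V → A → A) : Set where
  field
    resample : ∀ ψ → ψ Preserves _≈_ ⟶ _≡_ → c * ΣL ψ xs ≡ ΣL (λ v → ΣL (ψ ∘ u v) xs) vs
open Resamples

resamples-const : ∀ {n} → Resamples _≡_ (allFin n) (allFin n) n (λ v _ → v)
resamples-const {n} .resample ψ _ =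
  sym (trans (ΣL-cong (λ v → ΣL-allFin-const n (ψ v)) (allFin n)) (ΣL-*ˡ n ψ (allFin n)))

ΣL-allFunsOf-suc : ∀ {m} {xs : List A} (Φ : Vector A (suc m) → ℕ) →
  Φ Preserves Pointwise _≡_ ⟶ _≡_ →
  ΣL Φ (allFunsOf (suc m) xs) ≡ ΣL (λ a → ΣL (λ f → Φ (a ◂ f)) (allFunsOf m xs)) xs
ΣL-allFunsOf-suc {m = m} {xs} Φ Φ-ext =
  trans (ΣL-concatMap Φ _ xs) (ΣL-cong (λ a →
    trans (ΣL-map Φ _ (allFunsOf m xs))
          (ΣL-cong (λ f → Φ-ext λ { zero → refl ; (suc _) → refl }) (allFunsOf m xs))) xs)

updateAt-pointwise : ∀ {m} (i : Fin m) {g : A → A} {f f′ : Vector A m} →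
  Pointwise _≡_ f f′ → Pointwise _≡_ (updateAt f i g) (updateAt f′ i g)
updateAt-pointwise zero {g} f≗f′ zero    = cong g (f≗f′ zero)
updateAt-pointwise zero    f≗f′ (suc j) = f≗f′ (suc j)
updateAt-pointwise (suc i) f≗f′ zero    = f≗f′ zero
updateAt-pointwise (suc i) f≗f′ (suc j) = updateAt-pointwise i (f≗f′ ∘ suc) j

module _ {V : Set} {_≈_ : A → A → Set} (≈-refl : Reflexive _≈_)
         {xs : List A} {vs : List V} {c : ℕ} {u : V → A → A}
         (resamples : Resamples _≈_ xs vs c u) where

  private
    ≡⇒≈ : ∀ {m} {f f′ : Vector A m} → Pointwise _≡_ f f′ → Pointwise _≈_ f f′
    ≡⇒≈ f≗f′ i rewrite f≗f′ i = ≈-refl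

  resamples-updateAt : ∀ {m} (i : Fin m) →
    Resamples (Pointwise _≈_) (allFunsOf m xs) vs c (λ v f → updateAt f i (u v))
  resamples-updateAt {suc m} i .resample Φ Φ-resp = begin
      c * ΣL Φ (allFunsOf (suc m) xs)
    ≡⟨ cong (c *_) (ΣL-allFunsOf-suc {xs = xs} Φ (Φ-resp ∘ ≡⇒≈)) ⟩
      c * ΣL (λ a → ΣL (Φ ∘ (a ◂_)) (allFunsOf m xs)) xs
    ≡⟨ resample-head i ⟩
      ΣL (λ v → ΣL (λ a → ΣL (λ f → Φ (updateAt (a ◂ f) i (u v))) (allFunsOf m xs)) xs) vs
    ≡⟨ ΣL-cong (λ v → sym (ΣL-allFunsOf-suc {xs = xs} _ (Φ-resp ∘ ≡⇒≈ ∘ updateAt-pointwise i))) vs ⟩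
      ΣL (λ v → ΣL (λ f → Φ (updateAt f i (u v))) (allFunsOf (suc m) xs)) vs ∎
    where
    open ≡-Reasoning
    resample-head : ∀ i → c * ΣL (λ a → ΣL (Φ ∘ (a ◂_)) (allFunsOf m xs)) xs ≡
      ΣL (λ v → ΣL (λ a → ΣL (λ f → Φ (updateAt (a ◂ f) i (u v))) (allFunsOf m xs)) xs) vs
    resample-head zero = trans
      (resamples .resample _ λ a≈a′ →
        ΣL-cong (λ f → Φ-resp λ { zero → a≈a′ ; (suc _) → ≈-refl }) (allFunsOf m xs))
      (ΣL-cong (λ v → ΣL-cong (λ a → ΣL-cong (λ f →
        Φ-resp λ { zero → ≈-refl ; (suc _) → ≈-refl }) (allFunsOf m xs)) xs) vs)
    resample-head (suc i) = begin
        c * ΣL (λ a → ΣL (Φ ∘ (a ◂_)) (allFunsOf m xs)) xs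
      ≡⟨ sym (ΣL-*ˡ c _ xs) ⟩
        ΣL (λ a → c * ΣL (Φ ∘ (a ◂_)) (allFunsOf m xs)) xs
      ≡⟨ ΣL-cong (λ a → resamples-updateAt i .resample (Φ ∘ (a ◂_))
           (λ f≈f′ → Φ-resp λ { zero → ≈-refl ; (suc j) → f≈f′ j })) xs ⟩
        ΣL (λ a → ΣL (λ v → ΣL (λ f → Φ (a ◂ updateAt f i (u v))) (allFunsOf m xs)) vs) xs
      ≡⟨ ΣL-swap _ xs vs ⟩
        ΣL (λ v → ΣL (λ a → ΣL (λ f → Φ (a ◂ updateAt f i (u v))) (allFunsOf m xs)) xs) vs
      ≡⟨ ΣL-cong (λ v → ΣL-cong (λ a → ΣL-cong (λ f →
           Φ-resp λ { zero → ≈-refl ; (suc _) → ≈-refl }) (allFunsOf m xs)) xs) vs ⟩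
        ΣL (λ v → ΣL (λ a → ΣL (λ f → Φ (updateAt (a ◂ f) (suc i) (u v))) (allFunsOf m xs)) xs) vs ∎

_≋_ : ∀ {k n} → TArray k n → TArray k n → Set
_≋_ = Pointwise (Pointwise _≡_)

setCell : ∀ {k n} → TArray k n → Fin k → Fin n → Fin n → TArray k n
setCell B i x v = updateAt B i (λ row → updateAt row x (const v))

resample-cell : ∀ {k n} (i : Fin k) (x : Fin n) (Φ : TArray k n → ℕ) → Φ Preserves _≋_ ⟶ _≡_ →
  n * ΣL Φ (allArrays k n) ≡ ΣL (λ v → ΣL (λ B → Φ (setCell B i x v)) (allArrays k n)) (allFin n)
resample-cell i x =
  resamples-updateAt (λ _ → refl) (resamples-updateAt refl resamples-const x) i .resample

setCell-updates : ∀ {k n} (B : TArray k n) i x v → setCell B i x v i x ≡ v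
setCell-updates B i x v = trans (cong (_$ x) (updateAt-updates i B)) (updateAt-updates x (B i))

setCell-minimal : ∀ {k n} (B : TArray k n) {i j x y} v → (i , x) ≢ (j , y) →
  setCell B i x v j y ≡ B j y
setCell-minimal B {i} {j} {x} {y} v ix≢jy with i ≟ j
... | yes refl = trans (cong (_$ y) (updateAt-updates i B))
                       (updateAt-minimal y x (B i) (ix≢jy ∘ cong (i ,_) ∘ sym))
... | no i≢j   = cong (_$ y) (updateAt-minimal j i B (i≢j ∘ sym))

_⊑_ : ∀ {k n} → PArray k n → TArray k n → Set
Q ⊑ B = ∀ i x s → Q i x ≡ just s → B i x ≡ s

agrees⇒⊑ : ∀ {k n} (Q : PArray k n) B → T (agrees Q B) → Q ⊑ B
agrees⇒⊑ {k} {n} Q B ok i x s Qix≡s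
  with Q i x | Qix≡s | tabulate⁻ (all⁺ _ (allFin n) (tabulate⁻ (all⁺ _ (allFin k) ok) i)) x
... | .(just s) | refl | cell-ok = sym (toWitness cell-ok)

-- The cell test inside agrees is local to Defs; it is reached by abstracting over Q i x.
⊑⇒agrees : ∀ {k n} (Q : PArray k n) B → Q ⊑ B → T (agrees Q B)
⊑⇒agrees {k} {n} Q B Q⊑B with T? (agrees Q B)
... | yes ok = ok
... | no ¬ok with ¬∀⟶∃¬ k _ (λ _ → T? _) (¬ok ∘ all⁻ _ ∘ tabulate⁺)
... | i , ¬row-ok with ¬∀⟶∃¬ n _ (λ _ → T? _) (¬row-ok ∘ all⁻ _ ∘ tabulate⁺)
... | x , ¬cell-ok with Q i x | Q⊑B i x | ¬cell-ok
... | nothing | _      | ¬ok′ = contradiction _ ¬ok′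
... | just s  | filled | ¬ok′ = contradiction (fromWitness (sym (filled s refl))) ¬ok′

T-injective : ∀ {a b} → (T a → T b) → (T b → T a) → a ≡ b
T-injective {false} {false} _ _ = refl
T-injective {false} {true}  _ g = ⊥-elim (g _)
T-injective {true}  {false} f _ = ⊥-elim (f _)
T-injective {true}  {true}  _ _ = refl

𝟙 : Bool → ℕ
𝟙 b = if b then 1 else 0

𝟙≤1 : ∀ b → 𝟙 b ≤ 1
𝟙≤1 true  = ≤-refl
𝟙≤1 false = z≤n

𝟙-∧ : ∀ a b → 𝟙 (a ∧ b) ≡ 𝟙 a * 𝟙 b
𝟙-∧ true  b = sym (+-identityʳ (𝟙 b))
𝟙-∧ false b = refl

if-then-0 : ∀ b m → (if b then m else 0) ≡ 𝟙 b * m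
if-then-0 true  m = sym (+-identityʳ m)
if-then-0 false m = refl

𝟙[_⊑_] : ∀ {k n} → PArray k n → TArray k n → ℕ
𝟙[ Q ⊑ B ] = 𝟙 (agrees Q B)

𝟙⊑-resp : ∀ {k n} (Q : PArray k n) {B B′} →
  (∀ i x s → Q i x ≡ just s → B i x ≡ B′ i x) → 𝟙[ Q ⊑ B ] ≡ 𝟙[ Q ⊑ B′ ]
𝟙⊑-resp Q {B} {B′} B≐B′ = cong 𝟙 (T-injective
  (λ ok → ⊑⇒agrees Q B′ λ i x s e → trans (sym (B≐B′ i x s e)) (agrees⇒⊑ Q B ok i x s e))
  (λ ok → ⊑⇒agrees Q B  λ i x s e → trans (B≐B′ i x s e) (agrees⇒⊑ Q B′ ok i x s e)))

𝟙⊑-cong : ∀ {k n} (Q : PArray k n) → 𝟙[ Q ⊑_] Preserves _≋_ ⟶ _≡_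
𝟙⊑-cong Q B≋B′ = 𝟙⊑-resp Q λ i x _ _ → B≋B′ i x

𝟙⊑-setCell : ∀ {k n} (Q : PArray k n) {i x} → Q i x ≡ nothing → ∀ B v →
  𝟙[ Q ⊑ setCell B i x v ] ≡ 𝟙[ Q ⊑ B ]
𝟙⊑-setCell Q {i} {x} Qix≡∅ B v = 𝟙⊑-resp Q λ j y s Qjy≡s →
  setCell-minimal B v λ { refl → contradiction (trans (sym Qix≡∅) Qjy≡s) λ () }

𝟙⊑-support : ∀ {k n} (Q : PArray k n) B → 𝟙[ Q ⊑ B ] ≢ 0 → Q ⊑ B
𝟙⊑-support Q B ≢0 with agrees Q B in ok
... | true  = agrees⇒⊑ Q B (subst T (sym ok) _)
... | false = contradiction refl ≢0

δ : ∀ {n} → Fin n → Fin n → ℕ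
δ a b = 𝟙 ⌊ a ≟ b ⌋

δᴹ : ∀ {n} → Maybe (Fin n) → Maybe (Fin n) → ℕ
δᴹ c d = 𝟙 (eqM c d)

δ-refl : ∀ {n} (a : Fin n) → δ a a ≡ 1
δ-refl a with a ≟ a
... | yes _  = refl
... | no a≢a = contradiction refl a≢a

δ-≢ : ∀ {n} {a b : Fin n} → a ≢ b → δ a b ≡ 0
δ-≢ {a = a} {b} a≢b with a ≟ b
... | yes a≡b = contradiction a≡b a≢b
... | no _    = refl

δ-sym : ∀ {n} (a b : Fin n) → δ a b ≡ δ b a
δ-sym a b with a ≟ b
... | yes refl = sym (δ-refl a)
... | no a≢b   = sym (δ-≢ (a≢b ∘ sym))

δ-*-≤ : ∀ {n} (a b : Fin n) m → δ a b * m ≤ m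
δ-*-≤ a b m = ≤-trans (*-monoˡ-≤ m (𝟙≤1 ⌊ a ≟ b ⌋)) (≤-reflexive (*-identityˡ m))

ΣL-δ : ∀ {n} (b : Fin n) → ΣL (λ v → δ v b) (allFin n) ≡ 1
ΣL-δ {suc n} zero    = trans (ΣL-allFin-suc {m = n} (λ v → δ v zero))
  (cong suc (ΣL-zero (λ _ → refl) (allFin n)))
ΣL-δ {suc n} (suc b) = trans (ΣL-allFin-suc {m = n} (λ v → δ v (suc b)))
  (trans (ΣL-cong (λ v → cong 𝟙 (⌊⌋-map′ _ _ (v ≟ b))) (allFin n)) (ΣL-δ b))

-- Coincidences in a random completion

coincidence-≡ : ∀ {k n} {i j : Fin k} {x y : Fin n} → (i , x) ≢ (j , y) →
  (h : TArray k n → ℕ) → h Preserves _≋_ ⟶ _≡_ → (∀ B v → h (setCell B i x v) ≡ h B) →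
  n * ΣL (λ B → δ (B i x) (B j y) * h B) (allArrays k n) ≡ ΣL h (allArrays k n)
coincidence-≡ {k} {n} {i} {j} {x} {y} ix≢jy h h-ext h-free = begin
    n * ΣL (λ B → δ (B i x) (B j y) * h B) arrays
  ≡⟨ resample-cell i x _ (λ B≋B′ → cong₂ _*_ (cong₂ δ (B≋B′ i x) (B≋B′ j y)) (h-ext B≋B′)) ⟩
    ΣL (λ v → ΣL (λ B → δ (setCell B i x v i x) (setCell B i x v j y) * h (setCell B i x v)) arrays)
       (allFin n)
  ≡⟨ ΣL-cong (λ v → ΣL-cong (λ B → cong₂ _*_
       (cong₂ δ (setCell-updates B i x v) (setCell-minimal B v ix≢jy)) (h-free B v)) arrays) (allFin n) ⟩
    ΣL (λ v → ΣL (λ B → δ v (B j y) * h B) arrays) (allFin n)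
  ≡⟨ ΣL-swap _ (allFin n) arrays ⟩
    ΣL (λ B → ΣL (λ v → δ v (B j y) * h B) (allFin n)) arrays
  ≡⟨ ΣL-cong (λ B → trans (ΣL-*ʳ (h B) _ (allFin n))
       (trans (cong (_* h B) (ΣL-δ (B j y))) (*-identityˡ (h B)))) arrays ⟩
    ΣL h arrays ∎
  where
  open ≡-Reasoning
  arrays : List (TArray k n)
  arrays = allArrays k n

-- In probabilistic terms: Pr[B i x = B j y] ≤ 1/n + [Q i x = Q j y, both filled].
coincidence-≤ : ∀ {k n} (Q : PArray k n) {i j : Fin k} {x y : Fin n} → (i , x) ≢ (j , y) →
  (h : TArray k n → ℕ) → h Preserves _≋_ ⟶ _≡_ → (∀ B → h B ≢ 0 → Q ⊑ B) →
  (Q i x ≡ nothing → ∀ B v → h (setCell B i x v) ≡ h B) →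
  (Q j y ≡ nothing → ∀ B v → h (setCell B j y v) ≡ h B) →
  n * ΣL (λ B → δ (B i x) (B j y) * h B) (allArrays k n)
    ≤ (1 + n * δᴹ (Q i x) (Q j y)) * ΣL h (allArrays k n)
coincidence-≤ {k} {n} Q {i} {j} {x} {y} ix≢jy h h-ext h-supp h-free₁ h-free₂
  with Q i x in Qix | Q j y in Qjy
... | nothing | _ = ≤-trans (≤-reflexive (coincidence-≡ ix≢jy h h-ext (h-free₁ refl))) (m≤m+n _ _)
... | just a | nothing = ≤-trans (≤-reflexive (begin-equality
      n * ΣL (λ B → δ (B i x) (B j y) * h B) arrays
    ≡⟨ cong (n *_) (ΣL-cong (λ B → cong (_* h B) (δ-sym (B i x) (B j y))) arrays) ⟩
      n * ΣL (λ B → δ (B j y) (B i x) * h B) arrays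
    ≡⟨ coincidence-≡ (ix≢jy ∘ sym) h h-ext (h-free₂ refl) ⟩
      ΣL h arrays ∎)) (m≤m+n _ _)
  where
  open ≤-Reasoning
  arrays : List (TArray k n)
  arrays = allArrays k n
... | just a | just b with a ≟ b
... | yes refl = begin
      n * ΣL (λ B → δ (B i x) (B j y) * h B) arrays
    ≤⟨ *-monoʳ-≤ n (ΣL-mono (λ B → δ-*-≤ (B i x) (B j y) (h B)) arrays) ⟩
      n * ΣL h arrays
    ≡⟨ cong (_* ΣL h arrays) (sym (*-identityʳ n)) ⟩
      n * 1 * ΣL h arrays
    ≤⟨ m≤n+m _ _ ⟩
      (1 + n * 1) * ΣL h arrays ∎
  where
  open ≤-Reasoning
  arrays : List (TArray k n)
  arrays = allArrays k n
... | no a≢b = ≤-trans (≤-reflexive (*-ΣL-zero n vanishes (allArrays k n))) z≤n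
  where
  vanishes : ∀ B → δ (B i x) (B j y) * h B ≡ 0
  vanishes B with h B ≟ℕ 0
  ... | yes hB≡0 = trans (cong (δ (B i x) (B j y) *_) hB≡0) (*-zeroʳ (δ (B i x) (B j y)))
  ... | no hB≢0 = cong (_* h B) (δ-≢ λ Bix≡Bjy →
          a≢b (trans (sym (h-supp B hB≢0 i x a Qix)) (trans Bix≡Bjy (h-supp B hB≢0 j y b Qjy))))

intercalate-≤ : ∀ {k n} (Q : PArray k n) {i j : Fin k} {x y : Fin n} → i ≢ j → x ≢ y →
  n * n * ΣL (λ B → 𝟙[ Q ⊑ B ] * (δ (B i x) (B j y) * δ (B i y) (B j x))) (allArrays k n)
    ≤ (1 + n * δᴹ (Q i x) (Q j y)) * ((1 + n * δᴹ (Q i y) (Q j x)) * completionCount Q)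
intercalate-≤ {k} {n} Q {i} {j} {x} {y} i≢j x≢y = begin
    n * n * ΣL (λ B → 𝟙[ Q ⊑ B ] * (δ₁ B * δ₂ B)) arrays
  ≡⟨ trans (*-assoc n n _) (cong (λ s → n * (n * s)) (ΣL-cong (λ B →
       trans (*-comm 𝟙[ Q ⊑ B ] _) (*-assoc (δ₁ B) (δ₂ B) _)) arrays)) ⟩
    n * (n * ΣL (λ B → δ₁ B * h₂ B) arrays)
  ≤⟨ *-monoʳ-≤ n (coincidence-≤ Q (i≢j ∘ cong proj₁) h₂ h₂-ext h₂-support h₂-free₁ h₂-free₂) ⟩
    n * ((1 + n * δᴹ (Q i x) (Q j y)) * ΣL h₂ arrays)
  ≡⟨ x∙yz≈y∙xz n (1 + n * δᴹ (Q i x) (Q j y)) _ ⟩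
    (1 + n * δᴹ (Q i x) (Q j y)) * (n * ΣL (λ B → δ₂ B * 𝟙[ Q ⊑ B ]) arrays)
  ≤⟨ *-monoʳ-≤ (1 + n * δᴹ (Q i x) (Q j y)) (coincidence-≤ Q (i≢j ∘ cong proj₁) 𝟙[ Q ⊑_]
       (𝟙⊑-cong Q) (𝟙⊑-support Q) (𝟙⊑-setCell Q) (𝟙⊑-setCell Q)) ⟩
    (1 + n * δᴹ (Q i x) (Q j y)) * ((1 + n * δᴹ (Q i y) (Q j x)) * completionCount Q) ∎
  where
  open ≤-Reasoning
  arrays : List (TArray k n)
  arrays = allArrays k n
  δ₁ δ₂ h₂ : TArray k n → ℕ
  δ₁ B = δ (B i x) (B j y)
  δ₂ B = δ (B i y) (B j x)
  h₂ B = δ₂ B * 𝟙[ Q ⊑ B ]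
  h₂-ext : h₂ Preserves _≋_ ⟶ _≡_
  h₂-ext B≋B′ = cong₂ _*_ (cong₂ δ (B≋B′ i y) (B≋B′ j x)) (𝟙⊑-cong Q B≋B′)
  h₂-support : ∀ B → h₂ B ≢ 0 → Q ⊑ B
  h₂-support B h₂B≢0 = 𝟙⊑-support Q B λ 𝟙≡0 → h₂B≢0 (trans (cong (δ₂ B *_) 𝟙≡0) (*-zeroʳ (δ₂ B)))
  h₂-free₁ : Q i x ≡ nothing → ∀ B v → h₂ (setCell B i x v) ≡ h₂ B
  h₂-free₁ Qix≡∅ B v = cong₂ _*_
    (cong₂ δ (setCell-minimal B v (x≢y ∘ cong proj₂)) (setCell-minimal B v (i≢j ∘ cong proj₁)))
    (𝟙⊑-setCell Q Qix≡∅ B v)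
  h₂-free₂ : Q j y ≡ nothing → ∀ B v → h₂ (setCell B j y v) ≡ h₂ B
  h₂-free₂ Qjy≡∅ B v = cong₂ _*_
    (cong₂ δ (setCell-minimal B v (i≢j ∘ sym ∘ cong proj₁))
             (setCell-minimal B v (x≢y ∘ sym ∘ cong proj₂)))
    (𝟙⊑-setCell Q Qjy≡∅ B v)

-- Summing over quadruples

Quad : ℕ → ℕ → Set
Quad k n = (Fin k × Fin k) × (Fin n × Fin n)

pairs : ∀ m → List (Fin m × Fin m)
pairs m = cartesianProduct (allFin m) (allFin m)

quads : ∀ k n → List (Quad k n)
quads k n = cartesianProduct (pairs k) (pairs n)

ΣL-pairs : ∀ {m} (f : Fin m × Fin m → ℕ) → ΣL f (pairs m) ≡ ΣF m λ i → ΣF m λ j → f (i , j)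
ΣL-pairs {m} f = ΣL-cartesianProduct f (allFin m) (allFin m)

ΣL-quads : ∀ {k n} (f : Quad k n → ℕ) →
  ΣL f (quads k n) ≡ ΣF k λ i → ΣF k λ j → ΣF n λ x → ΣF n λ y → f ((i , j) , (x , y))
ΣL-quads {k} {n} f = begin
    ΣL f (quads k n)
  ≡⟨ ΣL-cartesianProduct f (pairs k) (pairs n) ⟩
    ΣL (λ p → ΣL (λ q → f (p , q)) (pairs n)) (pairs k)
  ≡⟨ ΣL-pairs {k} (λ p → ΣL (λ q → f (p , q)) (pairs n)) ⟩
    (ΣF k λ i → ΣF k λ j → ΣL (λ q → f ((i , j) , q)) (pairs n))
  ≡⟨ ΣL-cong (λ i → ΣL-cong (λ j → ΣL-pairs {n} (λ q → f ((i , j) , q))) (allFin k)) (allFin k) ⟩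
    (ΣF k λ i → ΣF k λ j → ΣF n λ x → ΣF n λ y → f ((i , j) , (x , y))) ∎
  where open ≡-Reasoning

intercalateAt : ∀ {k n} → PArray k n → Quad k n → ℕ
intercalateAt A ((i , j) , (x , y)) = interc A i j x y

N≡ΣL-quads : ∀ {k n} (A : PArray k n) → N A ≡ ΣL (intercalateAt A) (quads k n)
N≡ΣL-quads A = sym (ΣL-quads (intercalateAt A))

ascending : ∀ {m} → Fin m × Fin m → ℕ
ascending (i , j) = 𝟙 (toℕ i <ᵇ toℕ j)

diagonalMatch antidiagonalMatch : ∀ {k n} → PArray k n → Quad k n → ℕ
diagonalMatch     Q ((i , j) , (x , y)) = δᴹ (Q i x) (Q j y)
antidiagonalMatch Q ((i , j) , (x , y)) = δᴹ (Q i y) (Q j x)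

<ᵇ-irrefl : ∀ m → (m <ᵇ m) ≡ false
<ᵇ-irrefl zero    = refl
<ᵇ-irrefl (suc m) = <ᵇ-irrefl m

<ᵇ⇒≢ : ∀ {m} {i j : Fin m} → (toℕ i <ᵇ toℕ j) ≡ true → i ≢ j
<ᵇ⇒≢ {i = i} i<j refl with trans (sym i<j) (<ᵇ-irrefl (toℕ i))
... | ()

intercalateAt-≤ : ∀ {k n} (Q : PArray k n) (q : Quad k n) →
  n * n * ΣL (λ B → 𝟙[ Q ⊑ B ] * intercalateAt (full B) q) (allArrays k n)
    ≤ completionCount Q * (ascending (proj₁ q) * ascending (proj₂ q)
                           + n * (diagonalMatch Q q + antidiagonalMatch Q q) + n * n * intercalateAt Q q)
intercalateAt-≤ {k} {n} Q ((i , j) , (x , y)) with toℕ i <ᵇ toℕ j in i<j | toℕ x <ᵇ toℕ y in x<y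
... | false | _     = ≤-trans (≤-reflexive (*-ΣL-zero (n * n) (λ B → *-zeroʳ 𝟙[ Q ⊑ B ]) (allArrays k n)))
                              z≤n
... | true  | false = ≤-trans (≤-reflexive (*-ΣL-zero (n * n) (λ B → *-zeroʳ 𝟙[ Q ⊑ B ]) (allArrays k n)))
                              z≤n
... | true  | true  = begin
    n * n * ΣL (λ B → 𝟙[ Q ⊑ B ] * 𝟙 (⌊ B i x ≟ B j y ⌋ ∧ ⌊ B i y ≟ B j x ⌋)) arrays
  ≡⟨ cong (n * n *_) (ΣL-cong (λ B → cong (𝟙[ Q ⊑ B ] *_) (𝟙-∧ ⌊ B i x ≟ B j y ⌋ _)) arrays) ⟩
    n * n * ΣL (λ B → 𝟙[ Q ⊑ B ] * (δ (B i x) (B j y) * δ (B i y) (B j x))) arrays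
  ≤⟨ intercalate-≤ Q (<ᵇ⇒≢ i<j) (<ᵇ⇒≢ x<y) ⟩
    (1 + n * D₁) * ((1 + n * D₂) * C)
  ≡⟨ expand n D₁ D₂ C ⟩
    C * (1 + n * (D₁ + D₂) + n * n * (D₁ * D₂))
  ≡⟨ cong (λ d → C * (1 + n * (D₁ + D₂) + n * n * d)) (sym (𝟙-∧ (eqM (Q i x) (Q j y)) _)) ⟩
    C * (1 + n * (D₁ + D₂) + n * n * 𝟙 (eqM (Q i x) (Q j y) ∧ eqM (Q i y) (Q j x))) ∎
  where
  open ≤-Reasoning
  arrays : List (TArray k n)
  arrays = allArrays k n
  C D₁ D₂ : ℕ
  C  = completionCount Q
  D₁ = δᴹ (Q i x) (Q j y)
  D₂ = δᴹ (Q i y) (Q j x)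
  expand : ∀ n a b c → (1 + n * a) * ((1 + n * b) * c) ≡ c * (1 + n * (a + b) + n * n * (a * b))
  expand = solve-∀

completionSum≡ΣL-quads : ∀ {k n} (Q : PArray k n) → completionSum Q ≡
  ΣL (λ q → ΣL (λ B → 𝟙[ Q ⊑ B ] * intercalateAt (full B) q) (allArrays k n)) (quads k n)
completionSum≡ΣL-quads {k} {n} Q = begin
    completionSum Q
  ≡⟨ ΣL-cong (λ B → trans (if-then-0 (agrees Q B) _)
                          (cong (𝟙[ Q ⊑ B ] *_) (N≡ΣL-quads (full B)))) arrays ⟩
    ΣL (λ B → 𝟙[ Q ⊑ B ] * ΣL (intercalateAt (full B)) (quads k n)) arrays
  ≡⟨ ΣL-cong (λ B → sym (ΣL-*ˡ 𝟙[ Q ⊑ B ] _ (quads k n))) arrays ⟩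
    ΣL (λ B → ΣL (λ q → 𝟙[ Q ⊑ B ] * intercalateAt (full B) q) (quads k n)) arrays
  ≡⟨ ΣL-swap _ arrays (quads k n) ⟩
    ΣL (λ q → ΣL (λ B → 𝟙[ Q ⊑ B ] * intercalateAt (full B) q) arrays) (quads k n) ∎
  where
  open ≡-Reasoning
  arrays : List (TArray k n)
  arrays = allArrays k n

completionSum-≤-ΣL-quads : ∀ {k n} (Q : PArray k n) →
  n * n * completionSum Q ≤ completionCount Q *
    (ΣL (λ q → ascending (proj₁ q) * ascending (proj₂ q)) (quads k n)
     + n * ΣL (λ q → diagonalMatch Q q + antidiagonalMatch Q q) (quads k n) + n * n * N Q)
completionSum-≤-ΣL-quads {k} {n} Q = begin
    n * n * completionSum Q
  ≡⟨ trans (cong (n * n *_) (completionSum≡ΣL-quads Q)) (sym (ΣL-*ˡ (n * n) _ (quads k n))) ⟩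
    ΣL (λ q → n * n * ΣL (λ B → 𝟙[ Q ⊑ B ] * intercalateAt (full B) q) (allArrays k n)) (quads k n)
  ≤⟨ ΣL-mono (intercalateAt-≤ Q) (quads k n) ⟩
    ΣL (λ q → C * (o q + n * m q + n * n * intercalateAt Q q)) (quads k n)
  ≡⟨ ΣL-*ˡ C _ (quads k n) ⟩
    C * ΣL (λ q → o q + n * m q + n * n * intercalateAt Q q) (quads k n)
  ≡⟨ cong (C *_) (begin-equality
        ΣL (λ q → o q + n * m q + n * n * intercalateAt Q q) (quads k n)
      ≡⟨ ΣL-+ (λ q → o q + n * m q) _ (quads k n) ⟩
        ΣL (λ q → o q + n * m q) (quads k n) + ΣL (λ q → n * n * intercalateAt Q q) (quads k n)
      ≡⟨ cong₂ _+_ (trans (ΣL-+ o _ (quads k n)) (cong (ΣL o (quads k n) +_) (ΣL-*ˡ n m (quads k n))))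
                   (trans (ΣL-*ˡ (n * n) _ (quads k n)) (cong (n * n *_) (sym (N≡ΣL-quads Q)))) ⟩
        ΣL o (quads k n) + n * ΣL m (quads k n) + n * n * N Q ∎) ⟩
    C * (ΣL o (quads k n) + n * ΣL m (quads k n) + n * n * N Q) ∎
  where
  open ≤-Reasoning
  C : ℕ
  C = completionCount Q
  o m : Quad k n → ℕ
  o q = ascending (proj₁ q) * ascending (proj₂ q)
  m q = diagonalMatch Q q + antidiagonalMatch Q q

<ᵇ-asym : ∀ a b → 𝟙 (a <ᵇ b) + 𝟙 (b <ᵇ a) ≤ 1
<ᵇ-asym zero    zero    = z≤n
<ᵇ-asym zero    (suc b) = ≤-refl
<ᵇ-asym (suc a) zero    = ≤-refl
<ᵇ-asym (suc a) (suc b) = <ᵇ-asym a b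

2*ΣL-ascending≤ : ∀ m → 2 * ΣL ascending (pairs m) ≤ m * m
2*ΣL-ascending≤ m = begin
    2 * ΣL ascending (pairs m)
  ≡⟨ cong (2 *_) (ΣL-pairs {m} ascending) ⟩
    2 * S
  ≡⟨ cong (S +_) (trans (*-identityˡ S) (ΣL-swap lt (allFin m) (allFin m))) ⟩
    S + (ΣF m λ i → ΣF m λ j → lt j i)
  ≡⟨ sym (trans (ΣL-cong (λ i → ΣL-+ (lt i) (λ j → lt j i) (allFin m)) (allFin m)) (ΣL-+ _ _ (allFin m))) ⟩
    (ΣF m λ i → ΣF m λ j → lt i j + lt j i)
  ≤⟨ ΣL-mono (λ i → ΣL-mono (λ j → <ᵇ-asym (toℕ i) (toℕ j)) (allFin m)) (allFin m) ⟩
    (ΣF m λ _ → ΣF m λ _ → 1)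
  ≡⟨ trans (ΣL-cong (λ _ → trans (ΣL-allFin-const m 1) (*-identityʳ m)) (allFin m)) (ΣL-allFin-const m m) ⟩
    m * m ∎
  where
  open ≤-Reasoning
  lt : Fin m → Fin m → ℕ
  lt i j = ascending (i , j)
  S : ℕ
  S = ΣF m λ i → ΣF m λ j → lt i j

4*ΣL-ascending≤ : ∀ k n →
  4 * ΣL (λ q → ascending (proj₁ q) * ascending (proj₂ q)) (quads k n) ≤ k * k * (n * n)
4*ΣL-ascending≤ k n = begin
    4 * ΣL (λ q → ascending (proj₁ q) * ascending (proj₂ q)) (quads k n)
  ≡⟨ cong (4 *_) (trans (ΣL-cartesianProduct _ (pairs k) (pairs n))
       (trans (ΣL-cong (λ p → ΣL-*ˡ (ascending p) ascending (pairs n)) (pairs k))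
              (ΣL-*ʳ (ΣL ascending (pairs n)) ascending (pairs k)))) ⟩
    4 * (ΣL ascending (pairs k) * ΣL ascending (pairs n))
  ≡⟨ regroup (ΣL ascending (pairs k)) (ΣL ascending (pairs n)) ⟩
    2 * ΣL ascending (pairs k) * (2 * ΣL ascending (pairs n))
  ≤⟨ *-mono-≤ (2*ΣL-ascending≤ k) (2*ΣL-ascending≤ n) ⟩
    k * k * (n * n) ∎
  where
  open ≤-Reasoning
  regroup : ∀ a b → 4 * (a * b) ≡ 2 * a * (2 * b)
  regroup = solve-∀

ΣF-≤1 : ∀ {m} (f : Fin m → ℕ) → (∀ y → f y ≤ 1) → (∀ y y′ → f y ≢ 0 → f y′ ≢ 0 → y ≡ y′) →
  ΣF m f ≤ 1
ΣF-≤1 {zero}  f f≤1 unique = z≤n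
ΣF-≤1 {suc m} f f≤1 unique with f zero ≟ℕ 0
... | yes f0≡0 = begin
    ΣF (suc m) f
  ≡⟨ ΣL-allFin-suc f ⟩
    f zero + ΣF m (f ∘ suc)
  ≡⟨ cong (_+ ΣF m (f ∘ suc)) f0≡0 ⟩
    ΣF m (f ∘ suc)
  ≤⟨ ΣF-≤1 (f ∘ suc) (f≤1 ∘ suc) (λ y y′ p q → suc-injective (unique (suc y) (suc y′) p q)) ⟩
    1 ∎
  where open ≤-Reasoning
... | no f0≢0 = begin
    ΣF (suc m) f
  ≡⟨ ΣL-allFin-suc f ⟩
    f zero + ΣF m (f ∘ suc)
  ≡⟨ trans (cong (f zero +_) (ΣL-zero rest-vanishes (allFin m))) (+-identityʳ (f zero)) ⟩
    f zero
  ≤⟨ f≤1 zero ⟩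
    1 ∎
  where
  open ≤-Reasoning
  rest-vanishes : ∀ y → f (suc y) ≡ 0
  rest-vanishes y with f (suc y) ≟ℕ 0
  ... | yes fy≡0 = fy≡0
  ... | no fy≢0  = contradiction (unique zero (suc y) f0≢0 fy≢0) λ ()

δᴹ-just : ∀ {n} (s : Fin n) d → δᴹ (just s) d ≢ 0 → d ≡ just s
δᴹ-just s nothing  ≢0 = contradiction refl ≢0
δᴹ-just s (just t) ≢0 with s ≟ t
... | yes refl = refl
... | no _     = contradiction refl ≢0

ΣF-δᴹ-row : ∀ {n} (r : Fin n → Maybe (Fin n)) →
  (∀ x y s → x ≢ y → r x ≡ just s → ¬ (r y ≡ just s)) →
  ∀ c → ΣF n (λ y → δᴹ c (r y)) ≤ isJust? c
ΣF-δᴹ-row {n} r latin nothing  = ≤-reflexive (ΣL-zero (λ _ → refl) (allFin n))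
ΣF-δᴹ-row {n} r latin (just s) = ΣF-≤1 _ (λ y → 𝟙≤1 (eqM (just s) (r y))) unique
  where
  unique : ∀ y y′ → δᴹ (just s) (r y) ≢ 0 → δᴹ (just s) (r y′) ≢ 0 → y ≡ y′
  unique y y′ p q with y ≟ y′
  ... | yes y≡y′ = y≡y′
  ... | no y≢y′  = contradiction (δᴹ-just s (r y′) q) (latin y y′ s y≢y′ (δᴹ-just s (r y) p))

ΣL-diagonalMatch≤ : ∀ {k n} (Q : PArray k n) → IsPartialLatin Q →
  ΣL (diagonalMatch Q) (quads k n) ≤ k * size Q
ΣL-diagonalMatch≤ {k} {n} Q (rows-latin , _) = begin
    ΣL (diagonalMatch Q) (quads k n)
  ≡⟨ ΣL-quads (diagonalMatch Q) ⟩
    (ΣF k λ i → ΣF k λ j → ΣF n λ x → ΣF n λ y → δᴹ (Q i x) (Q j y))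
  ≤⟨ ΣL-mono (λ i → ΣL-mono (λ j → ΣL-mono (λ x →
       ΣF-δᴹ-row (Q j) (rows-latin j) (Q i x)) (allFin n)) (allFin k)) (allFin k) ⟩
    (ΣF k λ i → ΣF k λ _ → ΣF n λ x → isJust? (Q i x))
  ≡⟨ ΣL-cong (λ i → ΣL-allFin-const k _) (allFin k) ⟩
    (ΣF k λ i → k * ΣF n λ x → isJust? (Q i x))
  ≡⟨ ΣL-*ˡ k _ (allFin k) ⟩
    k * size Q ∎
  where open ≤-Reasoning

ΣL-antidiagonalMatch≡ : ∀ {k n} (Q : PArray k n) →
  ΣL (antidiagonalMatch Q) (quads k n) ≡ ΣL (diagonalMatch Q) (quads k n)
ΣL-antidiagonalMatch≡ {k} {n} Q = begin
    ΣL (antidiagonalMatch Q) (quads k n)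
  ≡⟨ ΣL-quads (antidiagonalMatch Q) ⟩
    (ΣF k λ i → ΣF k λ j → ΣF n λ x → ΣF n λ y → δᴹ (Q i y) (Q j x))
  ≡⟨ ΣL-cong (λ i → ΣL-cong (λ j → ΣL-swap (λ x y → δᴹ (Q i y) (Q j x)) (allFin n) (allFin n))
       (allFin k)) (allFin k) ⟩
    (ΣF k λ i → ΣF k λ j → ΣF n λ y → ΣF n λ x → δᴹ (Q i y) (Q j x))
  ≡⟨ sym (ΣL-quads (diagonalMatch Q)) ⟩
    ΣL (diagonalMatch Q) (quads k n) ∎
  where open ≡-Reasoning

-- E[N(A(Q))] ≤ k²/4 + 2k|Q|/n + N(Q), with denominators cleared.
completionSum-bound : ∀ {k n} (Q : PArray k n) → IsPartialLatin Q →
  4 * (n * n * completionSum Q)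
    ≤ completionCount Q * (k * k * (n * n) + 8 * n * (k * size Q) + 4 * (n * n) * N Q)
completionSum-bound {k} {n} Q latin = begin
    4 * (n * n * completionSum Q)
  ≤⟨ *-monoʳ-≤ 4 (completionSum-≤-ΣL-quads Q) ⟩
    4 * (C * (O + n * ΣL (λ q → diagonalMatch Q q + antidiagonalMatch Q q) (quads k n) + n * n * N Q))
  ≡⟨ cong (λ m → 4 * (C * (O + n * m + n * n * N Q)))
       (trans (ΣL-+ (diagonalMatch Q) _ (quads k n)) (cong (D +_) (ΣL-antidiagonalMatch≡ Q))) ⟩
    4 * (C * (O + n * (D + D) + n * n * N Q))
  ≡⟨ regroup C O n D (N Q) ⟩
    C * (4 * O + 8 * n * D + 4 * (n * n) * N Q)
  ≤⟨ *-monoʳ-≤ C (+-monoˡ-≤ (4 * (n * n) * N Q)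
       (+-mono-≤ (4*ΣL-ascending≤ k n) (*-monoʳ-≤ (8 * n) (ΣL-diagonalMatch≤ Q latin)))) ⟩
    C * (k * k * (n * n) + 8 * n * (k * size Q) + 4 * (n * n) * N Q) ∎
  where
  open ≤-Reasoning
  C O D : ℕ
  C = completionCount Q
  O = ΣL (λ q → ascending (proj₁ q) * ascending (proj₂ q)) (quads k n)
  D = ΣL (diagonalMatch Q) (quads k n)
  regroup : ∀ c o n d t →
    4 * (c * (o + n * (d + d) + n * n * t)) ≡ c * (4 * o + 8 * n * d + 4 * (n * n) * t)
  regroup = solve-∀

≤-from-squares : ∀ a b c n → .{{NonZero n}} → a ^ 2 * b ^ 2 ≤ c ^ 2 * n → a * b ≤ c * n
≤-from-squares a b c n ab²≤c²n = ≮⇒≥ λ cn<ab → <⇒≱ (^-monoˡ-< 2 cn<ab) (begin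
    (a * b) ^ 2
  ≡⟨ ^-distrib-* a b 2 ⟩
    a ^ 2 * b ^ 2
  ≤⟨ ab²≤c²n ⟩
    c ^ 2 * n
  ≤⟨ *-monoʳ-≤ (c ^ 2) (≤-trans (m≤m*n n n) (≤-reflexive (cong (n *_) (sym (*-identityʳ n))))) ⟩
    c ^ 2 * n ^ 2
  ≡⟨ sym (^-distrib-* c n 2) ⟩
    (c * n) ^ 2 ∎)
  where open ≤-Reasoning

trade-density : ∀ e n k S C Z t →
  4 * (n * n * S) ≤ C * (k * k * (n * n) + 8 * n * (k * Z) + 4 * (n * n) * t) →
  2 * e * Z ≤ k * n →
  n * n * (4 * e * S) ≤ n * n * ((e * k ^ 2 + 4 * e * t + 4 * k ^ 2) * C)
trade-density e n k S C Z t bound dense = begin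
    n * n * (4 * e * S)
  ≡⟨ regroup₁ n e S ⟩
    e * (4 * (n * n * S))
  ≤⟨ *-monoʳ-≤ e bound ⟩
    e * (C * (k * k * (n * n) + 8 * n * (k * Z) + 4 * (n * n) * t))
  ≡⟨ regroup₂ e C k n Z t ⟩
    C * (e * (k * k * (n * n)) + 4 * (n * k) * (2 * e * Z) + 4 * e * (n * n) * t)
  ≤⟨ *-monoʳ-≤ C (+-monoˡ-≤ (4 * e * (n * n) * t) (+-monoʳ-≤ (e * (k * k * (n * n)))
       (*-monoʳ-≤ (4 * (n * k)) dense))) ⟩
    C * (e * (k * k * (n * n)) + 4 * (n * k) * (k * n) + 4 * e * (n * n) * t)
  ≡⟨ regroup₃ e C k n t ⟩
    n * n * ((e * (k * k) + 4 * e * t + 4 * (k * k)) * C)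
  ≡⟨ cong (λ k² → n * n * ((e * k² + 4 * e * t + 4 * k²) * C)) (cong (k *_) (sym (*-identityʳ k))) ⟩
    n * n * ((e * k ^ 2 + 4 * e * t + 4 * k ^ 2) * C) ∎
  where
  open ≤-Reasoning
  regroup₁ : ∀ n e S → n * n * (4 * e * S) ≡ e * (4 * (n * n * S))
  regroup₁ = solve-∀
  regroup₂ : ∀ e C k n Z t → e * (C * (k * k * (n * n) + 8 * n * (k * Z) + 4 * (n * n) * t))
    ≡ C * (e * (k * k * (n * n)) + 4 * (n * k) * (2 * e * Z) + 4 * e * (n * n) * t)
  regroup₂ = solve-∀
  regroup₃ : ∀ e C k n t → C * (e * (k * k * (n * n)) + 4 * (n * k) * (k * n) + 4 * e * (n * n) * t)
    ≡ n * n * ((e * (k * k) + 4 * e * t + 4 * (k * k)) * C)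
  regroup₃ = solve-∀

lemma3p4 : (e : ℕ) → 1 ≤ e →
    Σ ℕ λ d → 1 ≤ d × Σ ℕ λ n₀ → (n k : ℕ) → n₀ ≤ n → (Q : PArray k n) →
      IsPartialLatin Q →
      d ^ 2 * size Q ^ 2 ≤ k ^ 2 * n →
      4 * e * completionSum Q ≤ (e * k ^ 2 + 4 * e * N Q + 4 * k ^ 2) * completionCount Q
lemma3p4 e 1≤e = 2 * e , ≤-trans 1≤e (m≤m+n e _) , 1 , bound
  where
  bound : (n k : ℕ) → 1 ≤ n → (Q : PArray k n) → IsPartialLatin Q →
    (2 * e) ^ 2 * size Q ^ 2 ≤ k ^ 2 * n →
    4 * e * completionSum Q ≤ (e * k ^ 2 + 4 * e * N Q + 4 * k ^ 2) * completionCount Q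
  bound n@(suc _) k _ Q latin sparse = *-cancelˡ-≤ (n * n)
    (trade-density e n k (completionSum Q) (completionCount Q) (size Q) (N Q)
      (completionSum-bound Q latin) (≤-from-squares (2 * e) (size Q) k n sparse))
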